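{- Let $G=(S,A,\downarrow,\to)$ be a labeled transition system, $B\subseteq A$, and let $(\mathcal P,\sqsubseteq)$ be a partition-relation pair over $G$. Define $R=\{(p,q)\in P\times Q\mid P,Q\in\mathcal P,\ P\sqsubseteq Q\}$. If $(\mathcal P,\sqsubseteq)$ is stable with respect to $\downarrow$, $\to$ and $B$, then $R$ is a partial bisimulation with respect to $B$ and $R$ is a preorder.
   Context: A labeled transition system is $G=(S,A,\downarrow,\to)$ with a set of states $S$, a set of actions $A$, a termination predicate $\downarrow\subseteq S$ (write $p\downarrow$) and a transition relation $\to\subseteq S\times A\times S$ (write $p\xrightarrow{a}q$). A relation $R\subseteq S\times S$ is a partial bisimulation with respect to $B\subseteq A$ if for all $(p,q)\in R$: (1) if $p\downarrow$ then $q\downarrow$; (2) if $p\xrightarrow{a}p'$ for some $a\in A$, then there is $q'$ with $q\xrightarrow{a}q'$ and $(p',q')\in R$; (3) if $q\xrightarrow{b}q'$ for some $b\in B$, then there is $p'$ with $p\xrightarrow{b}p'$ and $(p',q')\in R$. A partition-relation pair is $(\mathcal P,\sqsubseteq)$ where $\mathcal P$ is a partition of $S$ and $\sqsubseteq\subseteq\mathcal P\times\mathcal P$ is a partial order. For a class $P$ write $P\downarrow$ if all $p\in P$ terminate and $P\not\downarrow$ if none does. For $P,X\subseteq S$: $P\xrightarrow{a}_\exists X$ means some $p\in P$ has $p\xrightarrow{a}x$ with $x\in X$; $P\xrightarrow{a}_\forall X$ means every $p\in P$ has some $x\in X$ with $p\xrightarrow{a}x$. For $P\in\mathcal P$, $\mathrm{lb}(P)=\bigcup\{Q\in\mathcal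 P\mid Q\sqsubseteq P\}$, $\mathrm{bb}(P)=\bigcup\{Q\in\mathcal P\mid P\sqsubseteq Q\}$. $(\mathcal P,\sqsubseteq)$ is stable (w.r.t. $\downarrow,\to,B$) if: (a) every $P\in\mathcal P$ has $P\downarrow$ or $P\not\downarrow$; (b) if $P\sqsubseteq Q$ and $P\downarrow$ then $Q\downarrow$; (c) for all $P,Q,R\in\mathcal P$, $a\in A$: if $P\sqsubseteq Q$ and $P\xrightarrow{a}_\exists R$ then $Q\xrightarrow{a}_\forall\mathrm{bb}(R)$; (d) for all $P,Q,R\in\mathcal P$, $b\in B$: if $P\sqsubseteq Q$ and $Q\xrightarrow{b}_\exists R$ then $P\xrightarrow{b}_\forall\mathrm{lb}(R)$. -}

module Defs where

open import Data.Product using (Σ; ∃; _×_; _,_)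
open import Data.Sum using (_⊎_)
open import Relation.Nullary using (¬_)
open import Relation.Binary.PropositionalEquality using (_≡_)
open import Relation.Binary.Structures using (IsPartialOrder; IsPreorder)

record LTS : Set₁ where
  field
    S    : Set
    A    : Set
    Term : S → Set
    Step : S → A → S → Set

module _ (G : LTS) where
  open LTS G

  record IsPartialBisim (B : A → Set) (R : S → S → Set) : Set where
    field
      term : ∀ {p q} → R p q → Term p → Term q
      fwd  : ∀ {p q} → R p q → ∀ a p' → Step p a p' →
             ∃ λ q' → Step q a q' × R p' q'
      bwd  : ∀ {p q} → R p q → ∀ b → B b → ∀ q' → Step q b q' →
             ∃ λ p' → Step p b p' × R p' q'

  -- A partition-relation pair: a partition of S given by an index set
  -- of classes I and a class map `cls` (class of P = {p | cls p ≡ P}),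
  -- every class being nonempty, together with a partial order ⊑ on I.
  record PartitionRelationPair : Set₁ where
    field
      I         : Set
      cls       : S → I
      nonempty  : ∀ (P : I) → ∃ λ p → cls p ≡ P
      _⊑_       : I → I → Set
      isPO      : IsPartialOrder _≡_ _⊑_

  module _ (PR : PartitionRelationPair) where
    open PartitionRelationPair PR

    ClsTerm : I → Set
    ClsTerm P = ∀ p → cls p ≡ P → Term p

    ClsNoTerm : I → Set
    ClsNoTerm P = ∀ p → cls p ≡ P → ¬ Term p

    StepEx : I → A → (S → Set) → Set
    StepEx P a X = ∃ λ p → cls p ≡ P × (∃ λ x → X x × Step p a x)

    StepAll : I → A → (S → Set) → Set
    StepAll P a X = ∀ p → cls p ≡ P → ∃ λ x → X x × Step p a x

    lb : I → S → Set
    lb P x = cls x ⊑ P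

    bb : I → S → Set
    bb P x = P ⊑ cls x

    record Stable (B : A → Set) : Set where
      field
        split  : ∀ P → ClsTerm P ⊎ ClsNoTerm P
        termUp : ∀ {P Q} → P ⊑ Q → ClsTerm P → ClsTerm Q
        fwdSt  : ∀ {P Q R} a → P ⊑ Q → StepEx P a (λ x → cls x ≡ R) →
                 StepAll Q a (bb R)
        bwdSt  : ∀ {P Q R} b → B b → P ⊑ Q → StepEx Q b (λ x → cls x ≡ R) →
                 StepAll P b (lb R)

    InducedRel : S → S → Set
    InducedRel p q = cls p ⊑ cls q

module Submission where

open import Defs
open import Relation.Binary.PropositionalEquality
  using (_≡_; refl; cong; isEquivalence)
open import Relation.Binary.Structures using (IsPreorder; IsPartialOrder)
open import Data.Product using (∃; _×_; _,_)
open import Data.Sum using (inj₁; inj₂)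
open import Data.Empty using (⊥-elim)

module _ (G : LTS) (PR : PartitionRelationPair G) where
  open LTS G
  open PartitionRelationPair PR

  induced-isPreorder : IsPreorder _≡_ (InducedRel G PR)
  induced-isPreorder = record
    { isEquivalence = isEquivalence
    ; reflexive     = λ p≡q → reflexive (cong cls p≡q)
    ; trans         = trans
    }
    where open IsPartialOrder isPO using (reflexive; trans)

  module _ {B : A → Set} (stable : Stable G PR B) where
    open Stable stable

    -- A terminating state lies in a class that is not ̸↓, hence in one that is ↓.
    induced-term : ∀ {p q} → InducedRel G PR p q → Term p → Term q
    induced-term {p} {q} P⊑Q tp with split (cls p)
    ... | inj₁ P↓ = termUp P⊑Q P↓ q refl
    ... | inj₂ P̸↓ = ⊥-elim (P̸↓ p refl tp)

    induced-fwd : ∀ {p q} → InducedRel G PR p q → ∀ a p' → Step p a p' →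
                  ∃ λ q' → Step q a q' × InducedRel G PR p' q'
    induced-fwd {p} {q} P⊑Q a p' p→p'
      with fwdSt {R = cls p'} a P⊑Q (p , refl , p' , refl , p→p') q refl
    ... | q' , R⊑Q' , q→q' = q' , q→q' , R⊑Q'

    induced-bwd : ∀ {p q} → InducedRel G PR p q → ∀ b → B b → ∀ q' → Step q b q' →
                  ∃ λ p' → Step p b p' × InducedRel G PR p' q'
    induced-bwd {p} {q} P⊑Q b b∈B q' q→q'
      with bwdSt {R = cls q'} b b∈B P⊑Q (q , refl , q' , refl , q→q') p refl
    ... | p' , P'⊑R , p→p' = p' , p→p' , P'⊑R

    induced-isPartialBisim : IsPartialBisim G B (InducedRel G PR)
    induced-isPartialBisim = record
      { term = induced-term
      ; fwd  = induced-fwd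
      ; bwd  = induced-bwd
      }

theorem3 : (G : LTS) (B : LTS.A G → Set) (PR : PartitionRelationPair G) →
    Stable G PR B →
    IsPartialBisim G B (InducedRel G PR) × IsPreorder _≡_ (InducedRel G PR)
theorem3 G B PR stable = induced-isPartialBisim G PR stable , induced-isPreorder G PR
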